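{- Given integers $f, g, h$ with $g\ge 1$, $2g\ge f+1$, $h\le f$, consider two Frobenius symbols \[ L=\begin{pmatrix} a_1 & \cdots & a_{t-1} \\ b_1 & \cdots & b_{t-1} \end{pmatrix}\quad\text{and}\quad R=\begin{pmatrix} \alpha_1 & \cdots & \alpha_{\tau} \\ \beta_1 & \cdots & \beta_{\tau}\end{pmatrix}\neq \emptyset, \] such that (i) $a_y - b_y \le f$ for all $1\le y \le t-1$, (ii) $\alpha_1 - \beta_1 \le f-2g+1$, (iii) $a_{t-1}> \beta_1-g+f+1$, (iv) $b_{t-1}> \alpha_1+g-f-1 \ge 0$. Let \[ \mu=\begin{pmatrix} \mu_{11} & \mu_{12} & \cdots & \mu_{1\delta'}\\ \mu_{21} & \mu_{22} & \cdots & \mu_{2\delta'}\end{pmatrix}:=s_{g+1}(L)\,d_{f-2g+1}(R), \] where the first $t-1$ columns of $\mu$ are those of $s_{g+1}(L)$ and the remaining columns are those of $d_{f-2g+1}(R)$. Then: (1) $\mu$ is a Frobenius symbol. (2) $\mu_{1y} - \mu_{2y} \le f-2g-2$ for all $1\le y \le t-1$, and $\mu_{1t} - \mu_{2t} \ge f-2g-1$ if $\mu_{1t}$ and $\mu_{2t}$ exist. (3) $\mathrm{rank}(\mu)\le h-2g-2$ if $L\ne \emptyset$ and $\mathrm{rank}(L) \le h$. (4) The correspondence from $(L,R)$ to $\mu$ is reversible. (5) $|L|+|R|-|\mu|=2g-f$.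
   Context: A Frobenius symbol is a two-rowed array $\begin{pmatrix} a_1 & \cdots & a_\delta\\ b_1 & \cdots & b_\delta\end{pmatrix}$ with $a_1>\cdots>a_\delta\ge 0$, $b_1>\cdots>b_\delta\ge0$, representing a partition of $\sum_t(a_t+b_t+1)$ (via $a_t=\lambda_t-t$, $b_t=\lambda'_t-t$ for $t$ up to the Durfee square size); Frobenius symbols are identified with ordinary partitions, the empty symbol with the empty partition $\emptyset$. $|\lambda|$ is the sum of parts, $\ell(\lambda)$ the number of parts, and $\mathrm{rank}(\lambda)=\lambda_1-\ell(\lambda)$, which equals $a_1-b_1$ for the first column of the Frobenius symbol; $\mathrm{rank}(\emptyset)=0$. For a partition $\lambda$ with $\mathrm{rank}(\lambda)\le r$, the Dyson map $d_r(\lambda)$ is obtained by subtracting $1$ from each part of $\lambda$ and then adding a part of size $r-1+\ell(\lambda)$; $d_r(\lambda)$ is a partition of $|\lambda|+r-1$ with $\mathrm{rank}(d_r(\lambda))\ge r-2$, and if nonempty its Frobenius symbol has upper-left entry $b_1+r-1$. The shift map $s_u$ sends $\begin{pmatrix} a_1 & \cdots & a_\delta\\ b_1 & \cdots & b_\delta\end{pmatrix}$ to $\begin{pmatrix} a_1-u & \cdots & a_\delta-u\\ b_1+u & \cdots & b_\delta+u\end{pmatrix}$, with $s_u(\emptyset)=\emptyset$ and $s_u^{ -1}=s_{ -u}$. -}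

module Defs where

open import Data.Nat as ℕ using (ℕ; zero; suc)
import Data.Nat.Properties as ℕP
open import Data.Integer as ℤ using (ℤ; +_; -[1+_]; _+_; _-_; _*_; _≤_; _<_)
open import Data.List using (List; []; _∷_; _++_; map; length; filter; take; drop)
open import Data.List.Relation.Unary.All using (All)
open import Data.List.Relation.Unary.Linked using (Linked)
open import Data.Product using (_×_; _,_; proj₁; proj₂)
open import Relation.Binary.PropositionalEquality using (_≡_; _≢_)
open import Relation.Nullary using (yes; no)

-- Two-rowed arrays (columns (upper , lower)), integer entries so that
-- the shift map s_u is defined on all arrays.

Array : Set
Array = List (ℤ × ℤ)

_≻_ : ℤ × ℤ → ℤ × ℤ → Set
(a , b) ≻ (a' , b') = (a' < a) × (b' < b)

IsFrob : Array → Set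
IsFrob F = All (λ c → (+ 0 ≤ proj₁ c) × (+ 0 ≤ proj₂ c)) F × Linked _≻_ F

weight : Array → ℤ
weight [] = + 0
weight ((a , b) ∷ F) = a + b + + 1 + weight F

rankF : Array → ℤ
rankF [] = + 0
rankF ((a , b) ∷ _) = a - b

shift : ℤ → Array → Array
shift u = map (λ c → (proj₁ c - u , proj₂ c + u))

_≽_ : ℕ → ℕ → Set
x ≽ y = y ℕ.≤ x

IsPartition : List ℕ → Set
IsPartition λs = All (λ x → 1 ℕ.≤ x) λs × Linked _≽_ λs

conjPart : List ℕ → ℕ → ℕ
conjPart λs j = length (filter (λ x → j ℕP.≤? x) λs)

-- Frobenius symbol of a partition: columns (λ_t - t , λ'_t - t) for
-- t = 1 .. (Durfee square size), i.e. while λ_t ≥ t.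
frobGo : List ℕ → ℕ → List ℕ → Array
frobGo λs t [] = []
frobGo λs t (x ∷ xs) with t ℕP.≤? x
... | yes _ = (+ x - + t , + conjPart λs t - + t) ∷ frobGo λs (suc t) xs
... | no _ = []

frob : List ℕ → Array
frob λs = frobGo λs 1 λs

-- truncation ℤ → ℕ (negative ↦ 0); only used where the argument is ≥ 0
clampℕ : ℤ → ℕ
clampℕ (+ n) = n
clampℕ -[1+ n ] = 0

-- Dyson map d_r (for rank λ ≤ r): subtract 1 from each part and add a
-- part of size r - 1 + ℓ(λ); zero parts are discarded.
dyson : ℤ → List ℕ → List ℕ
dyson r λs = filter (λ x → 1 ℕP.≤? x) (clampℕ (r - + 1 + + length λs) ∷ map ℕ.pred λs)

-- The construction of Lemma 3.4:  μ = s_{g+1}(L) d_{f-2g+1}(R),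
-- where R is the Frobenius symbol of the partition λR.

mu : ℤ → ℤ → Array → List ℕ → Array
mu f g L λR = shift (g + + 1) L ++ frob (dyson (f - + 2 * g + + 1) λR)

-- Hypotheses of Lemma 3.4 on (L , R), R = frob λR, t - 1 = length L.
record Hyp (f g : ℤ) (L : Array) (λR : List ℕ) : Set where
  field
    L-frob   : IsFrob L
    R-part   : IsPartition λR
    R-ne     : λR ≢ []
    cond-i   : All (λ c → proj₁ c - proj₂ c ≤ f) L
    -- (ii) and the "≥ 0" part of (iv), about the first column (α₁ , β₁) of R
    cond-ii  : ∀ α β Rs → frob λR ≡ (α , β) ∷ Rs → α - β ≤ f - + 2 * g + + 1
    cond-iv₀ : ∀ α β Rs → frob λR ≡ (α , β) ∷ Rs → + 0 ≤ α + g - f - + 1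
    -- (iii) and (iv), about the last column (a_{t-1} , b_{t-1}) of L
    cond-iii : ∀ Ls a b α β Rs → L ≡ Ls ++ ((a , b) ∷ []) → frob λR ≡ (α , β) ∷ Rs →
               β - g + f + + 1 < a
    cond-iv  : ∀ Ls a b α β Rs → L ≡ Ls ++ ((a , b) ∷ []) → frob λR ≡ (α , β) ∷ Rs →
               α + g - f - + 1 < b

module Submission where

-- Everything about the Frobenius symbol of a partition comes from one recursion,
--   frob (p ∷ ps) = (p - 1 , ℓ(ps)) ∷ frob (peel ps),
-- where peel deletes the first column of the Young diagram (subtract 1 from every part,
-- discard zeros).  Induction along peeling then shows that frob of a partition is a
-- Frobenius symbol, has weight |λ|, and is injective.  The Dyson map adds a new part m and
-- peels; when the parts of λ are at most m + 1 the result is a partition of size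
-- |λ| + m - ℓ(λ) whose Frobenius symbol starts with a column (m - 1 , y), y ≤ ℓ(λ), and the
-- new part m can be read off from the result.  The shift s_u preserves weights, is
-- injective, and s_u(L) ++ F is a Frobenius symbol as soon as the last column of L fits
-- in front of F.
-- For the theorem, hypothesis (iii) places the last column of L beyond (m + g , ·), which
-- gives (1); (2) and (3) compute column differences; (5) adds up weights; and (4) holds
-- because μ splits uniquely into the columns with a - b ≤ f - 2g - 2, which form s_{g+1}(L),
-- followed by d(R), from which L and λR are recovered by the injectivity results.

open import Defs
open import Data.Nat as ℕ using (ℕ; zero; suc; z≤n; s≤s)
import Data.Nat.Properties as ℕP
open import Data.Integer as ℤ using (ℤ; +_; _+_; _-_; _*_; _≤_; _<_)
import Data.Integer.Properties as ℤP
open import Data.Integer.Tactic.RingSolver using (solve-∀)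
open import Data.List using (List; []; _∷_; length; take; drop; filter; map; _++_; head; last)
open import Data.List.Properties
  using (∷-injective; length-filter; length-map; filter-accept; filter-reject; map-injective)
open import Data.Nat.ListAction using (sum)
open import Data.List.Relation.Unary.All as All using (All; []; _∷_)
import Data.List.Relation.Unary.All.Properties as AllP
open import Data.List.Relation.Unary.Linked as Linked using (Linked; []; [-]; _∷_; _∷′_)
import Data.List.Relation.Unary.Linked.Properties as LinkedP
open import Data.Maybe using (just)
open import Data.Maybe.Relation.Unary.All as Maybe using (just; nothing)
open import Data.Maybe.Relation.Binary.Connected using (Connected; just; just-nothing)
open import Data.Product using (_×_; _,_; proj₁; proj₂)
open import Data.Product.Properties using (,-injectiveˡ; ,-injectiveʳ)
open import Data.Empty using (⊥; ⊥-elim)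
open import Relation.Binary.PropositionalEquality
open import Relation.Nullary using (¬_; yes; no)
open import Function using (_∘′_)

-- Linear-arithmetic bridge: X ≤ Y follows from a known x ≤ y whenever Y + x = X + y.
-- The identity is a ring normalisation, left to the ring solver at each use.
≤-by : ∀ {x y X Y : ℤ} → x ≤ y → Y + x ≡ X + y → X ≤ Y
≤-by {x} {y} {X} {Y} x≤y eq = begin
  X            ≡⟨ add-sub X y ⟩
  X + y - y    ≡⟨ cong (_- y) eq ⟨
  Y + x - y    ≤⟨ ℤP.+-monoˡ-≤ (ℤ.- y) (ℤP.+-monoʳ-≤ Y x≤y) ⟩
  Y + y - y    ≡⟨ add-sub Y y ⟨
  Y            ∎
  where
  open ℤP.≤-Reasoning
  add-sub : ∀ (i j : ℤ) → i ≡ i + j - j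
  add-sub = solve-∀

clamp-nonneg : ∀ z → + 0 ≤ z → + clampℕ z ≡ z
clamp-nonneg (+ _) _ = refl

no-integer-between : ∀ K d → K - + 1 ≤ d → d ≤ K - + 2 → ⊥
no-integer-between K d lower upper = one≰zero (≤-by (ℤP.≤-trans lower upper) (gap K))
  where
  gap : ∀ (K : ℤ) → + 0 + (K - + 1) ≡ + 1 + (K - + 2)
  gap = solve-∀
  one≰zero : ¬ (+ 1 ≤ + 0)
  one≰zero (ℤ.+≤+ ())

connected : ∀ {A : Set} {R : A → A → Set} {x : A} {my} → Maybe.All (R x) my → Connected R (just x) my
connected (just r) = just r
connected nothing = just-nothing

at-head : ∀ {A : Set} {P : A → Set} {xs : List A} {x rest} →
  Maybe.All P (head xs) → xs ≡ x ∷ rest → P x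
at-head p refl = Maybe.drop-just p

split-unique : ∀ {A : Set} {P : A → Set} xs xs' ys ys' → All P xs → All P xs' →
  Maybe.All (λ c → ¬ P c) (head ys) → Maybe.All (λ c → ¬ P c) (head ys') →
  xs ++ ys ≡ xs' ++ ys' → (xs ≡ xs') × (ys ≡ ys')
split-unique [] [] _ _ _ _ _ _ eq = refl , eq
split-unique [] (_ ∷ _) _ _ _ (px' ∷ _) (just ¬px') _ refl = ⊥-elim (¬px' px')
split-unique (_ ∷ _) [] _ _ (px ∷ _) _ _ (just ¬px) refl = ⊥-elim (¬px px)
split-unique (x ∷ xs) (x' ∷ xs') ys ys' (_ ∷ pxs) (_ ∷ pxs') ¬ys ¬ys' eq
  with refl , tails ← ∷-injective eq
  with refl , refl ← split-unique xs xs' ys ys' pxs pxs' ¬ys ¬ys' tails = refl , refl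

take-prefix : ∀ {A : Set} n (xs ys : List A) → length xs ≡ n → take n (xs ++ ys) ≡ xs
take-prefix _ [] ys refl = refl
take-prefix _ (x ∷ xs) ys refl = cong (x ∷_) (take-prefix _ xs ys refl)

drop-prefix : ∀ {A : Set} n (xs ys : List A) → length xs ≡ n → drop n (xs ++ ys) ≡ ys
drop-prefix _ [] ys refl = refl
drop-prefix _ (x ∷ xs) ys refl = drop-prefix _ xs ys refl

-- The hypotheses speak about the last column through decompositions xs = ys ++ [c].
last-from-snoc : ∀ {A : Set} {P : A → Set} (xs : List A) →
  (∀ ys c → xs ≡ ys ++ c ∷ [] → P c) → Maybe.All P (last xs)
last-from-snoc [] _ = nothing
last-from-snoc (x ∷ []) h = just (h [] x refl)
last-from-snoc (x ∷ y ∷ xs) h = last-from-snoc (y ∷ xs) (λ ys c eq → h (x ∷ ys) c (cong (x ∷_) eq))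

Positive : List ℕ → Set
Positive = All (1 ℕ.≤_)

Decreasing : List ℕ → Set
Decreasing = Linked _≽_

≽-trans : ∀ {x y z} → x ≽ y → y ≽ z → x ≽ z
≽-trans x≽y y≽z = ℕP.≤-trans y≽z x≽y

bounded-by-head : ∀ {x xs} → Decreasing (x ∷ xs) → All (ℕ._≤ x) (x ∷ xs)
bounded-by-head = LinkedP.Linked⇒All ≽-trans ℕP.≤-refl

partition-tail : ∀ {p ps} → IsPartition (p ∷ ps) → IsPartition ps
partition-tail (_ ∷ pos , dec) = pos , Linked.tail dec

-- peel λ deletes the first column of the Young diagram of λ.
peel : List ℕ → List ℕ
peel xs = filter (1 ℕP.≤?_) (map ℕ.pred xs)

peel-partition : ∀ {xs} → IsPartition xs → IsPartition (peel xs)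
peel-partition {xs} (_ , dec) =
  AllP.all-filter (1 ℕP.≤?_) (map ℕ.pred xs) ,
  LinkedP.filter⁺ (1 ℕP.≤?_) ≽-trans (LinkedP.map⁺ (Linked.map ℕP.pred-mono-≤ dec))

peel-length : ∀ xs → length (peel xs) ℕ.≤ length xs
peel-length xs = ℕP.≤-trans (length-filter (1 ℕP.≤?_) (map ℕ.pred xs))
                            (ℕP.≤-reflexive (length-map ℕ.pred xs))

peel-small : ∀ xs → All (ℕ._≤ 1) xs → peel xs ≡ []
peel-small [] _ = refl
peel-small (zero ∷ xs) (_ ∷ small) = peel-small xs small
peel-small (suc zero ∷ xs) (_ ∷ small) = peel-small xs small
peel-small (suc (suc _) ∷ _) (s≤s () ∷ _)

peel-below : ∀ {b} xs → All (ℕ._≤ b) xs → All (ℕ._< b) (peel xs)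
peel-below [] _ = []
peel-below (zero ∷ xs) (_ ∷ bs) = peel-below xs bs
peel-below (suc zero ∷ xs) (_ ∷ bs) = peel-below xs bs
peel-below (suc (suc x) ∷ xs) (x≤b ∷ bs) = x≤b ∷ peel-below xs bs

peel-sum : ∀ xs → Positive xs → sum (peel xs) ℕ.+ length xs ≡ sum xs
peel-sum [] _ = refl
peel-sum (suc zero ∷ xs) (_ ∷ pos) =
  trans (ℕP.+-suc (sum (peel xs)) (length xs)) (cong suc (peel-sum xs pos))
peel-sum (suc (suc x) ∷ xs) (_ ∷ pos) = begin
  suc x ℕ.+ sum (peel xs) ℕ.+ suc (length xs)     ≡⟨ ℕP.+-suc (suc x ℕ.+ sum (peel xs)) (length xs) ⟩
  suc (suc x ℕ.+ sum (peel xs) ℕ.+ length xs)     ≡⟨ cong (suc ∘′ suc) (ℕP.+-assoc x (sum (peel xs)) (length xs)) ⟩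
  suc (suc (x ℕ.+ (sum (peel xs) ℕ.+ length xs))) ≡⟨ cong (λ s → suc (suc (x ℕ.+ s))) (peel-sum xs pos) ⟩
  suc (suc x ℕ.+ sum xs)                           ∎
  where open ≡-Reasoning

peel-injective : ∀ xs ys → IsPartition xs → IsPartition ys →
  length xs ≡ length ys → peel xs ≡ peel ys → xs ≡ ys
peel-injective [] [] _ _ _ _ = refl
peel-injective (zero ∷ _) _ (() ∷ _ , _) _ _ _
peel-injective _ (zero ∷ _) _ (() ∷ _ , _) _ _
peel-injective (suc zero ∷ xs) (suc zero ∷ ys) pxs pys len eq =
  cong (1 ∷_) (peel-injective xs ys (partition-tail pxs) (partition-tail pys) (ℕP.suc-injective len) eq)
peel-injective (suc zero ∷ xs) (suc (suc _) ∷ _) (_ , dec) _ _ eq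
  with () ← trans (sym (peel-small xs (All.tail (bounded-by-head dec)))) eq
peel-injective (suc (suc _) ∷ _) (suc zero ∷ ys) _ (_ , dec) _ eq
  with () ← trans eq (peel-small ys (All.tail (bounded-by-head dec)))
peel-injective (suc (suc x) ∷ xs) (suc (suc y) ∷ ys) pxs pys len eq
  with refl , tails ← ∷-injective eq =
  cong (suc (suc x) ∷_)
    (peel-injective xs ys (partition-tail pxs) (partition-tail pys) (ℕP.suc-injective len) tails)

conjPart-cons : ∀ {j p} ps → j ℕ.≤ p → conjPart (p ∷ ps) j ≡ suc (conjPart ps j)
conjPart-cons {j} ps j≤p = cong length (filter-accept (j ℕP.≤?_) j≤p)

conjPart-one : ∀ xs → Positive xs → conjPart xs 1 ≡ length xs
conjPart-one [] _ = refl
conjPart-one (x ∷ xs) (1≤x ∷ pos) = trans (conjPart-cons xs 1≤x) (cong suc (conjPart-one xs pos))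

conjPart-peel : ∀ k xs → conjPart (peel xs) (suc k) ≡ conjPart xs (suc (suc k))
conjPart-peel k [] = refl
conjPart-peel k (zero ∷ xs) = conjPart-peel k xs
conjPart-peel k (suc zero ∷ xs) = conjPart-peel k xs
conjPart-peel k (suc (suc x) ∷ xs) with k ℕP.≤? x
... | yes k≤x = begin
  conjPart (suc x ∷ peel xs) (suc k)  ≡⟨ conjPart-cons (peel xs) (s≤s k≤x) ⟩
  suc (conjPart (peel xs) (suc k))    ≡⟨ cong suc (conjPart-peel k xs) ⟩
  suc (conjPart xs (suc (suc k)))     ≡⟨ conjPart-cons xs (s≤s (s≤s k≤x)) ⟨
  conjPart (suc (suc x) ∷ xs) (suc (suc k)) ∎
  where open ≡-Reasoning
... | no k≰x = begin
  conjPart (suc x ∷ peel xs) (suc k)  ≡⟨ cong length (filter-reject (suc k ℕP.≤?_) (k≰x ∘′ ℕ.s≤s⁻¹)) ⟩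
  conjPart (peel xs) (suc k)          ≡⟨ conjPart-peel k xs ⟩
  conjPart xs (suc (suc k))           ≡⟨ cong length (filter-reject (suc (suc k) ℕP.≤?_) (k≰x ∘′ ℕ.s≤s⁻¹ ∘′ ℕ.s≤s⁻¹)) ⟨
  conjPart (suc (suc x) ∷ xs) (suc (suc k)) ∎
  where open ≡-Reasoning

suc-minus-suc : ∀ a b → + suc a - + suc b ≡ + a - + b
suc-minus-suc a b = begin
  + suc a - + suc b ≡⟨ ℤP.m-n≡m⊖n (suc a) (suc b) ⟩
  suc a ℤ.⊖ suc b   ≡⟨ ℤP.[1+m]⊖[1+n]≡m⊖n a b ⟩
  a ℤ.⊖ b           ≡⟨ ℤP.m-n≡m⊖n a b ⟨
  + a - + b         ∎
  where open ≡-Reasoning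

frobGo-accept : ∀ P t x xs → t ℕ.≤ x →
  frobGo P t (x ∷ xs) ≡ (+ x - + t , + conjPart P t - + t) ∷ frobGo P (suc t) xs
frobGo-accept P t x xs t≤x with t ℕP.≤? x
... | yes _ = refl
... | no t≰x = ⊥-elim (t≰x t≤x)

frobGo-reject : ∀ P t x xs → ¬ (t ℕ.≤ x) → frobGo P t (x ∷ xs) ≡ []
frobGo-reject P t x xs t≰x with t ℕP.≤? x
... | yes t≤x = ⊥-elim (t≰x t≤x)
... | no _ = refl

-- Columns t + 2 of p ∷ ps are the columns t + 1 of peel ps: arm λ_t - t and leg λ'_t - t
-- are unchanged by deleting the first row and column.  Here xs are the rows from t + 2 on.
frobGo-peel : ∀ p ps k xs → All (ℕ._≤ p) xs → Positive xs → Decreasing xs →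
  frobGo (p ∷ ps) (suc (suc k)) xs ≡ frobGo (peel ps) (suc k) (peel xs)
frobGo-peel p ps k [] _ _ _ = refl
frobGo-peel p ps k (zero ∷ xs) _ (() ∷ _) _
frobGo-peel p ps k (suc zero ∷ xs) _ _ dec =
  trans (frobGo-reject (p ∷ ps) (suc (suc k)) 1 xs λ { (s≤s ()) })
        (cong (frobGo (peel ps) (suc k)) (sym (peel-small xs (All.tail (bounded-by-head dec)))))
frobGo-peel p ps k (suc (suc x) ∷ xs) (x≤p ∷ bs) (_ ∷ pos) dec with k ℕP.≤? x
... | yes k≤x = begin
  frobGo (p ∷ ps) (suc (suc k)) (suc (suc x) ∷ xs)
    ≡⟨ frobGo-accept (p ∷ ps) (suc (suc k)) (suc (suc x)) xs (s≤s (s≤s k≤x)) ⟩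
  (+ suc (suc x) - + suc (suc k) , + conjPart (p ∷ ps) (suc (suc k)) - + suc (suc k))
    ∷ frobGo (p ∷ ps) (suc (suc (suc k))) xs
    ≡⟨ cong₂ _∷_ (cong₂ _,_ (suc-minus-suc (suc x) (suc k)) leg)
                 (frobGo-peel p ps (suc k) xs bs pos (Linked.tail dec)) ⟩
  (+ suc x - + suc k , + conjPart (peel ps) (suc k) - + suc k) ∷ frobGo (peel ps) (suc (suc k)) (peel xs)
    ≡⟨ frobGo-accept (peel ps) (suc k) (suc x) (peel xs) (s≤s k≤x) ⟨
  frobGo (peel ps) (suc k) (suc x ∷ peel xs) ∎
  where
  open ≡-Reasoning
  leg : + conjPart (p ∷ ps) (suc (suc k)) - + suc (suc k) ≡ + conjPart (peel ps) (suc k) - + suc k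
  leg = begin
    + conjPart (p ∷ ps) (suc (suc k)) - + suc (suc k)
      ≡⟨ cong (λ c → + c - + suc (suc k)) (conjPart-cons ps (ℕP.≤-trans (s≤s (s≤s k≤x)) x≤p)) ⟩
    + suc (conjPart ps (suc (suc k))) - + suc (suc k)
      ≡⟨ suc-minus-suc (conjPart ps (suc (suc k))) (suc k) ⟩
    + conjPart ps (suc (suc k)) - + suc k
      ≡⟨ cong (λ c → + c - + suc k) (conjPart-peel k ps) ⟨
    + conjPart (peel ps) (suc k) - + suc k ∎
... | no k≰x =
  trans (frobGo-reject (p ∷ ps) (suc (suc k)) (suc (suc x)) xs (k≰x ∘′ ℕ.s≤s⁻¹ ∘′ ℕ.s≤s⁻¹))
        (sym (frobGo-reject (peel ps) (suc k) (suc x) (peel xs) (k≰x ∘′ ℕ.s≤s⁻¹)))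

frob-cons : ∀ {p ps} → IsPartition (p ∷ ps) → frob (p ∷ ps) ≡ (+ p - + 1 , + length ps) ∷ frob (peel ps)
frob-cons {p} {ps} (1≤p ∷ pos , dec) = begin
  frob (p ∷ ps)
    ≡⟨ frobGo-accept (p ∷ ps) 1 p ps 1≤p ⟩
  (+ p - + 1 , + conjPart (p ∷ ps) 1 - + 1) ∷ frobGo (p ∷ ps) 2 ps
    ≡⟨ cong₂ (λ leg F → (+ p - + 1 , leg) ∷ F) leg
             (frobGo-peel p ps 0 ps (All.tail (bounded-by-head dec)) pos (Linked.tail dec)) ⟩
  (+ p - + 1 , + length ps) ∷ frob (peel ps) ∎
  where
  open ≡-Reasoning
  leg : + conjPart (p ∷ ps) 1 - + 1 ≡ + length ps
  leg = begin
    + conjPart (p ∷ ps) 1 - + 1 ≡⟨ cong (λ c → + c - + 1) (conjPart-one (p ∷ ps) (1≤p ∷ pos)) ⟩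
    + suc (length ps) - + 1     ≡⟨ suc-minus-suc (length ps) 0 ⟩
    + length ps - + 0           ≡⟨ ℤP.+-identityʳ (+ length ps) ⟩
    + length ps                 ∎

-- Induction along peeling: peel ps is no longer than ps, so a property passing from
-- peel ps to p ∷ ps holds for every list (by recursion on a length bound).
peel-induction : (Q : List ℕ → Set) → Q [] → (∀ p ps → Q (peel ps) → Q (p ∷ ps)) → ∀ xs → Q xs
peel-induction Q base step xs = go (length xs) xs ℕP.≤-refl
  where
  go : ∀ n xs → length xs ℕ.≤ n → Q xs
  go _ [] _ = base
  go (suc n) (p ∷ ps) (s≤s len) = step p ps (go n (peel ps) (ℕP.≤-trans (peel-length ps) len))

frob-first-column-below : ∀ {b k} P → IsPartition P → All (ℕ._< b) P → length P ℕ.≤ k →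
  Maybe.All ((+ b - + 1 , + k) ≻_) (head (frob P))
frob-first-column-below [] _ _ _ = nothing
frob-first-column-below (q ∷ qs) part (q<b ∷ _) len rewrite frob-cons part =
  just (ℤP.+-mono-<-≤ (ℤ.+<+ q<b) (ℤP.≤-refl {ℤ.- + 1}) , ℤ.+<+ len)

-- The Frobenius symbol of a partition is a Frobenius symbol: its first column
-- (p - 1 , ℓ(ps)) is nonnegative and strictly dominates the first column of peel ps.
frob-isFrob : ∀ P → IsPartition P → IsFrob (frob P)
frob-isFrob = peel-induction (λ P → IsPartition P → IsFrob (frob P)) (λ _ → [] , []) step
  where
  step : ∀ p ps → (IsPartition (peel ps) → IsFrob (frob (peel ps))) →
    IsPartition (p ∷ ps) → IsFrob (frob (p ∷ ps))
  step p ps ih part@(1≤p ∷ _ , dec) = subst IsFrob (sym (frob-cons part))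
    ( (ℤP.i≤j⇒0≤j-i (ℤ.+≤+ 1≤p) , ℤ.+≤+ z≤n) ∷ proj₁ rest
    , connected (frob-first-column-below (peel ps) peeled
                   (peel-below ps (All.tail (bounded-by-head dec))) (peel-length ps))
      ∷′ proj₂ rest )
    where
    peeled : IsPartition (peel ps)
    peeled = peel-partition (partition-tail part)
    rest : IsFrob (frob (peel ps))
    rest = ih peeled

frob-weight : ∀ P → IsPartition P → weight (frob P) ≡ + sum P
frob-weight = peel-induction (λ P → IsPartition P → weight (frob P) ≡ + sum P) (λ _ → refl) step
  where
  step : ∀ p ps → (IsPartition (peel ps) → weight (frob (peel ps)) ≡ + sum (peel ps)) →
    IsPartition (p ∷ ps) → weight (frob (p ∷ ps)) ≡ + sum (p ∷ ps)
  step p ps ih part = begin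
    weight (frob (p ∷ ps))
      ≡⟨ cong weight (frob-cons part) ⟩
    (+ p - + 1) + + length ps + + 1 + weight (frob (peel ps))
      ≡⟨ cong (λ w → (+ p - + 1) + + length ps + + 1 + w) (ih (peel-partition (partition-tail part))) ⟩
    (+ p - + 1) + + length ps + + 1 + + sum (peel ps)
      ≡⟨ regroup (+ p) (+ length ps) (+ sum (peel ps)) ⟩
    + p + + (sum (peel ps) ℕ.+ length ps)
      ≡⟨ cong (λ s → + p + + s) (peel-sum ps (proj₁ (partition-tail part))) ⟩
    + sum (p ∷ ps) ∎
    where
    open ≡-Reasoning
    regroup : ∀ (i l s : ℤ) → (i - + 1) + l + + 1 + s ≡ i + (s + l)
    regroup = solve-∀

minus-one-injective : ∀ {p q} → + p - + 1 ≡ + q - + 1 → p ≡ q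
minus-one-injective {p} {q} eq =
  ℤP.+-injective (trans (restore (+ p)) (trans (cong (_+ + 1) eq) (sym (restore (+ q)))))
  where
  restore : ∀ (i : ℤ) → i ≡ i - + 1 + + 1
  restore = solve-∀

frob-injective : ∀ P Q → IsPartition P → IsPartition Q → frob P ≡ frob Q → P ≡ Q
frob-injective = peel-induction Inj base step
  where
  Inj : List ℕ → Set
  Inj P = ∀ Q → IsPartition P → IsPartition Q → frob P ≡ frob Q → P ≡ Q
  base : Inj []
  base [] _ _ _ = refl
  base (q ∷ qs) _ partQ eq with () ← trans eq (frob-cons partQ)
  step : ∀ p ps → Inj (peel ps) → Inj (p ∷ ps)
  step p ps ih [] partP _ eq with () ← trans (sym eq) (frob-cons partP)
  step p ps ih (q ∷ qs) partP partQ eq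
    with firsts , rests ← ∷-injective (trans (sym (frob-cons partP)) (trans eq (frob-cons partQ))) =
    cong₂ _∷_ (minus-one-injective (,-injectiveˡ firsts))
      (peel-injective ps qs (partition-tail partP) (partition-tail partQ)
        (ℤP.+-injective (,-injectiveʳ firsts))
        (ih (peel qs) (peel-partition (partition-tail partP)) (peel-partition (partition-tail partQ)) rests))

-- The Dyson map with new part m, so that d_r(λ) = dysonWith (r - 1 + ℓ(λ)) λ.  It
-- computes peel λ when m = 0 and m ∷ peel λ otherwise.
dysonWith : ℕ → List ℕ → List ℕ
dysonWith m λs = filter (1 ℕP.≤?_) (m ∷ map ℕ.pred λs)

-- If the parts of λ are at most m + 1, the new part m may head the peeled partition.
dyson-partition : ∀ m {λs} → IsPartition λs → All (ℕ._≤ suc m) λs → IsPartition (dysonWith m λs)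
dyson-partition zero {λs} _ small = subst IsPartition (sym (peel-small λs small)) ([] , [])
dyson-partition (suc m) {λs} part bound =
  s≤s z≤n ∷ proj₁ peeled ,
  connected (AllP.head⁺ (All.map ℕ.s≤s⁻¹ (peel-below λs bound))) ∷′ proj₂ peeled
  where
  peeled : IsPartition (peel λs)
  peeled = peel-partition part

dyson-sum : ∀ m {λs} → Positive λs → sum (dysonWith m λs) ℕ.+ length λs ≡ m ℕ.+ sum λs
dyson-sum zero {λs} pos = peel-sum λs pos
dyson-sum (suc m) {λs} pos =
  trans (ℕP.+-assoc (suc m) (sum (peel λs)) (length λs)) (cong (suc m ℕ.+_) (peel-sum λs pos))

DysonHead : ℕ → ℕ → ℤ × ℤ → Set
DysonHead m ℓ c = (proj₁ c ≡ + m - + 1) × (proj₂ c ≤ + ℓ)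

dyson-first-column : ∀ m {λs} → IsPartition λs → All (ℕ._≤ suc m) λs →
  Maybe.All (DysonHead m (length λs)) (head (frob (dysonWith m λs)))
dyson-first-column zero {λs} _ small rewrite peel-small λs small = nothing
dyson-first-column (suc m) {λs} part bound =
  subst (λ F → Maybe.All (DysonHead (suc m) (length λs)) (head F)) (sym (frob-cons {suc m} {peel λs} (dyson-partition (suc m) part bound)))
    (just (refl , ℤ.+≤+ (peel-length λs)))

dyson-injective : ∀ m m' {λs λs'} → All (ℕ._≤ suc m) λs → All (ℕ._≤ suc m') λs' →
  dysonWith m λs ≡ dysonWith m' λs' → (m ≡ m') × (peel λs ≡ peel λs')
dyson-injective zero zero _ _ eq = refl , eq
dyson-injective (suc m) (suc m') _ _ eq = ∷-injective eq
dyson-injective zero (suc m') {λs} small _ eq with () ← trans (sym (peel-small λs small)) eq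
dyson-injective (suc m) zero {λs' = λs'} _ small eq with () ← trans eq (peel-small λs' small)

shiftCol : ℤ → ℤ × ℤ → ℤ × ℤ
shiftCol u c = (proj₁ c - u , proj₂ c + u)

weight-++ : ∀ xs ys → weight (xs ++ ys) ≡ weight xs + weight ys
weight-++ [] ys = sym (ℤP.+-identityˡ (weight ys))
weight-++ ((a , b) ∷ xs) ys =
  trans (cong (λ w → a + b + + 1 + w) (weight-++ xs ys)) (sym (ℤP.+-assoc (a + b + + 1) (weight xs) (weight ys)))

-- s_u moves u cells from the first row to the second, so |s_u(L)| = |L|.
shift-weight : ∀ u L → weight (shift u L) ≡ weight L
shift-weight u [] = refl
shift-weight u ((a , b) ∷ L) =
  trans (cong (λ w → (a - u) + (b + u) + + 1 + w) (shift-weight u L)) (cong (_+ weight L) (balance u a b))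
  where
  balance : ∀ (u a b : ℤ) → (a - u) + (b + u) + + 1 ≡ a + b + + 1
  balance = solve-∀

shift-injective : ∀ u {L L'} → shift u L ≡ shift u L' → L ≡ L'
shift-injective u = map-injective column-injective
  where
  restore : ∀ (u a : ℤ) → a ≡ a - u + u
  restore = solve-∀
  restore' : ∀ (u b : ℤ) → b ≡ b + u - u
  restore' = solve-∀
  column-injective : ∀ {c d} → shiftCol u c ≡ shiftCol u d → c ≡ d
  column-injective {a , b} {a' , b'} eq = cong₂ _,_
    (trans (restore u a) (trans (cong (_+ u) (,-injectiveˡ eq)) (sym (restore u a'))))
    (trans (restore' u b) (trans (cong (_- u) (,-injectiveʳ eq)) (sym (restore' u b'))))

-- Prepending the shift of a column c ≻ d to a Frobenius symbol starting with s_u(d)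
-- keeps it a Frobenius symbol (u ≥ 0 keeps the second row nonnegative).
shift-prepend : ∀ u c d G → + 0 ≤ u → + 0 ≤ proj₂ c → c ≻ d →
  IsFrob (shiftCol u d ∷ G) → IsFrob (shiftCol u c ∷ shiftCol u d ∷ G)
shift-prepend u c d G 0≤u 0≤b (a'<a , b'<b) (nonneg , linked) =
  (ℤP.≤-trans (proj₁ (All.head nonneg)) (ℤP.<⇒≤ shifted-a) , ℤP.+-mono-≤ 0≤b 0≤u) ∷ nonneg
  , (shifted-a , ℤP.+-monoˡ-< u b'<b) ∷ linked
  where
  shifted-a : proj₁ d - u < proj₁ c - u
  shifted-a = ℤP.+-monoˡ-< (ℤ.- u) a'<a

-- The first row of s_u(L) stays
-- nonnegative because it decreases towards its last entry a - u ≥ 0.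
shift-++-isFrob : ∀ u L F → + 0 ≤ u → IsFrob L → IsFrob F →
  Maybe.All (λ c → (u ≤ proj₁ c) × Connected _≻_ (just (shiftCol u c)) (head F)) (last L) →
  IsFrob (shift u L ++ F)
shift-++-isFrob u [] F _ _ frobF _ = frobF
shift-++-isFrob u (c ∷ []) F 0≤u ((_ , 0≤b) ∷ [] , _) (nonnegF , linkedF) (just (u≤a , fits)) =
  (ℤP.i≤j⇒0≤j-i u≤a , ℤP.+-mono-≤ 0≤b 0≤u) ∷ nonnegF , fits ∷′ linkedF
shift-++-isFrob u (c ∷ L@(d ∷ _)) F 0≤u (nonnegL , linkedL) frobF lastFits =
  shift-prepend u c d _ 0≤u (proj₂ (All.head nonnegL)) (Linked.head linkedL)
    (shift-++-isFrob u L F 0≤u (All.tail nonnegL , Linked.tail linkedL) frobF lastFits)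

shiftCol-difference : ∀ g K a b → a - b ≤ K → (a - (g + + 1)) - (b + (g + + 1)) ≤ K - + 2 * g - + 2
shiftCol-difference g K a b a-b≤K = ≤-by a-b≤K (lowered K g a b)
  where
  lowered : ∀ (K g a b : ℤ) → (K - + 2 * g - + 2) + (a - b) ≡ ((a - (g + + 1)) - (b + (g + + 1))) + K
  lowered = solve-∀

shift-++-rank : ∀ g K L F → L ≢ [] → rankF L ≤ K → rankF (shift (g + + 1) L ++ F) ≤ K - + 2 * g - + 2
shift-++-rank g K [] F L≢[] _ = ⊥-elim (L≢[] refl)
shift-++-rank g K ((a , b) ∷ L) F _ rank≤K = shiftCol-difference g K a b rank≤K

-- Here
-- (α₁ , β₁) = (l - 1 , ℓ(ls)) is the first column of R, the Dyson map d_r with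
-- r = f - 2g + 1 adds the part m = r + β₁, and FD is the Frobenius symbol of d_r(λR).
module Construction (f g : ℤ) (1≤g : + 1 ≤ g) {L : Array} {l : ℕ} {ls : List ℕ}
                    (hyp : Hyp f g L (l ∷ ls)) where

  u r α₁ β₁ : ℤ
  u = g + + 1
  r = f - + 2 * g + + 1
  α₁ = + l - + 1
  β₁ = + length ls

  0≤u : + 0 ≤ u
  0≤u = ℤP.+-mono-≤ (ℤP.≤-trans (ℤ.+≤+ z≤n) 1≤g) (ℤ.+≤+ z≤n)

  partR : IsPartition (l ∷ ls)
  partR = Hyp.R-part hyp

  R-first : frob (l ∷ ls) ≡ (α₁ , β₁) ∷ frob (peel ls)
  R-first = frob-cons partR

  cond-ii : α₁ - β₁ ≤ r
  cond-ii = Hyp.cond-ii hyp α₁ β₁ (frob (peel ls)) R-first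

  0≤α₁ : + 0 ≤ α₁
  0≤α₁ = ℤP.i≤j⇒0≤j-i (ℤ.+≤+ (All.head (proj₁ partR)))

  m : ℕ
  m = clampℕ (r - + 1 + + length (l ∷ ls))

  -- m = r + β₁ ≥ α₁ ≥ 0 by (ii).
  m-value : + m ≡ r + β₁
  m-value = trans (clamp-nonneg (r - + 1 + (+ 1 + β₁)) (≤-by (ℤP.+-mono-≤ cond-ii 0≤α₁) (nonneg r α₁ β₁)))
                  (simplify r β₁)
    where
    nonneg : ∀ (r α β : ℤ) → (r - + 1 + (+ 1 + β)) + (α - β + + 0) ≡ + 0 + (r + α)
    nonneg = solve-∀
    simplify : ∀ (r β : ℤ) → r - + 1 + (+ 1 + β) ≡ r + β
    simplify = solve-∀

  -- The first part l = α₁ + 1 ≤ m + 1, so every part of λR is at most m + 1.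
  parts-bounded : All (ℕ._≤ suc m) (l ∷ ls)
  parts-bounded = All.map (λ x≤l → ℕP.≤-trans x≤l l≤1+m) (bounded-by-head (proj₂ partR))
    where
    bound : ∀ (r α β : ℤ) → + 1 + (r + β) + (α - β) ≡ (α + + 1) + r
    bound = solve-∀
    restore : ∀ (i : ℤ) → i - + 1 + + 1 ≡ i
    restore = solve-∀
    l≤1+m : l ℕ.≤ suc m
    l≤1+m = ℤP.drop‿+≤+ (subst₂ _≤_ (restore (+ l)) (cong (λ k → + 1 + k) (sym m-value))
                                    (≤-by cond-ii (bound r α₁ β₁)))

  -- FD = d_r(λR) as a Frobenius symbol, so that μ = s_u(L) ++ FD.
  FD : Array
  FD = frob (dysonWith m (l ∷ ls))

  FD-isFrob : IsFrob FD
  FD-isFrob = frob-isFrob _ (dyson-partition m partR parts-bounded)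

  FD-first : Maybe.All (DysonHead m (length (l ∷ ls))) (head FD)
  FD-first = dyson-first-column m partR parts-bounded

  FD-first-difference : Maybe.All (λ c → f - + 2 * g - + 1 ≤ proj₁ c - proj₂ c) (head FD)
  FD-first-difference = Maybe.map difference FD-first
    where
    identity : ∀ (f g β y : ℤ) → ((f - + 2 * g + + 1 + β) - + 1 - y) + y ≡ (f - + 2 * g - + 1) + (+ 1 + β)
    identity = solve-∀
    difference : ∀ {c} → DysonHead m (length (l ∷ ls)) c → f - + 2 * g - + 1 ≤ proj₁ c - proj₂ c
    difference {x , y} (x≡m-1 , y≤ℓ) =
      subst (λ x → f - + 2 * g - + 1 ≤ x - y) (sym (trans x≡m-1 (cong (_- + 1) m-value)))
        (≤-by y≤ℓ (identity f g β₁ y))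

  last-column-far : ∀ {a} → β₁ - g + f + + 1 < a → r + β₁ + u ≤ a
  last-column-far {a} iii = ≤-by (ℤP.i<j⇒suc[i]≤j iii) (identity f g β₁ a)
    where
    identity : ∀ (f g β a : ℤ) → a + (+ 1 + (β - g + f + + 1)) ≡ (f - + 2 * g + + 1 + β + (g + + 1)) + a
    identity = solve-∀

  last-column-fits : ∀ {a b} → r + β₁ + u ≤ a → a - b ≤ f →
    (u ≤ a) × Connected _≻_ (just (shiftCol u (a , b))) (head FD)
  last-column-fits {a} {b} far a-b≤f =
    ℤP.≤-trans (≤-by (ℤP.+-mono-≤ cond-ii 0≤α₁) (room f g α₁ β₁)) far ,
    connected (Maybe.map junction FD-first)
    where
    room : ∀ (f g α β : ℤ) → (f - + 2 * g + + 1 + β + (g + + 1)) + (α - β + + 0) ≡ (g + + 1) + ((f - + 2 * g + + 1) + α)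
    room = solve-∀
    below-arm : ∀ (f g β a : ℤ) → (a - (g + + 1)) + (f - + 2 * g + + 1 + β + (g + + 1)) ≡ (+ 1 + (f - + 2 * g + + 1 + β - + 1)) + a
    below-arm = solve-∀
    below-leg : ∀ (f g β a b : ℤ) → (b + (g + + 1)) + ((f - + 2 * g + + 1 + β + (g + + 1)) + (a - b) + + 0) ≡ (+ 1 + (+ 1 + β)) + (a + f + + 1)
    below-leg = solve-∀
    junction : ∀ {c} → DysonHead m (length (l ∷ ls)) c → shiftCol u (a , b) ≻ c
    junction {x , y} (x≡m-1 , y≤ℓ) =
      subst (_< a - u) (sym (trans x≡m-1 (cong (_- + 1) m-value)))
            (ℤP.suc[i]≤j⇒i<j (≤-by far (below-arm f g β₁ a))) ,
      ℤP.≤-<-trans y≤ℓ (ℤP.suc[i]≤j⇒i<j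
        (≤-by (ℤP.+-mono-≤ (ℤP.+-mono-≤ far a-b≤f) (ℤ.+≤+ z≤n)) (below-leg f g β₁ a b)))

  last-column : Maybe.All (λ c → (u ≤ proj₁ c) × Connected _≻_ (just (shiftCol u c)) (head FD)) (last L)
  last-column = Maybe.zipWith (λ (iii , i) → last-column-fits (last-column-far iii) i)
    ( last-from-snoc L (λ Ls c eq → Hyp.cond-iii hyp Ls (proj₁ c) (proj₂ c) α₁ β₁ (frob (peel ls)) eq R-first)
    , AllP.last⁺ (Hyp.cond-i hyp) )

  -- μ unfolds definitionally to s_u(L) ++ FD.
  μ : Array
  μ = mu f g L (l ∷ ls)

  μ-isFrob : IsFrob μ
  μ-isFrob = shift-++-isFrob u L FD 0≤u (Hyp.L-frob hyp) FD-isFrob last-column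

  -- Columns of s_{g+1}(L) have a - b ≤ f - 2g - 2, by (i); those are exactly the columns
  -- before FD, since the first column of FD violates this bound.
  InPrefix : ℤ × ℤ → Set
  InPrefix c = proj₁ c - proj₂ c ≤ f - + 2 * g - + 2

  prefix-bounded : All InPrefix (shift u L)
  prefix-bounded = AllP.map⁺ (All.map (λ {c} → shiftCol-difference g f (proj₁ c) (proj₂ c)) (Hyp.cond-i hyp))

  FD-starts-outside : Maybe.All (λ c → ¬ InPrefix c) (head FD)
  FD-starts-outside = Maybe.map (λ {c} → no-integer-between (f - + 2 * g) (proj₁ c - proj₂ c)) FD-first-difference

  μ-prefix : All InPrefix (take (length L) μ)
  μ-prefix = subst (All InPrefix) (sym (take-prefix (length L) (shift u L) FD (length-map _ L))) prefix-bounded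

  μ-suffix : ∀ x y rest → drop (length L) μ ≡ (x , y) ∷ rest → f - + 2 * g - + 1 ≤ x - y
  μ-suffix x y rest eq = at-head FD-first-difference (trans (sym (drop-prefix (length L) (shift u L) FD (length-map _ L))) eq)

  -- (5): |μ| = |L| + |d_r(λR)| = |L| + |λR| + m - ℓ(λR), and m - ℓ(λR) = r - 1 = f - 2g.
  μ-weight : weight L + + sum (l ∷ ls) - weight μ ≡ + 2 * g - f
  μ-weight = begin
    weight L + S - weight μ
      ≡⟨ cong (λ w → weight L + S - w) weight-μ ⟩
    weight L + S - (weight L + SD)
      ≡⟨ cancel (weight L) S SD (+ 1 + β₁) ⟩
    (+ 1 + β₁) + S - (SD + (+ 1 + β₁))
      ≡⟨ cong (λ w → (+ 1 + β₁) + S - w) (cong +_ (dyson-sum m (proj₁ partR))) ⟩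
    (+ 1 + β₁) + S - (+ m + S)
      ≡⟨ cong (λ k → (+ 1 + β₁) + S - (k + S)) m-value ⟩
    (+ 1 + β₁) + S - (r + β₁ + S)
      ≡⟨ conclude f g β₁ S ⟩
    + 2 * g - f ∎
    where
    open ≡-Reasoning
    S SD : ℤ
    S = + sum (l ∷ ls)
    SD = + sum (dysonWith m (l ∷ ls))
    weight-μ : weight μ ≡ weight L + SD
    weight-μ = trans (weight-++ (shift u L) FD)
                     (cong₂ _+_ (shift-weight u L) (frob-weight _ (dyson-partition m partR parts-bounded)))
    cancel : ∀ (W S SD k : ℤ) → W + S - (W + SD) ≡ k + S - (SD + k)
    cancel = solve-∀
    conclude : ∀ (f g β S : ℤ) → (+ 1 + β) + S - (f - + 2 * g + + 1 + β + S) ≡ + 2 * g - f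
    conclude = solve-∀

-- The columns of μ with a - b ≤ f - 2g - 2 form s_{g+1}(L),
-- the rest is the Frobenius symbol of d_r(λR); the Dyson map then reveals m = r + ℓ(ls),
-- hence ℓ(λR), and the peeled partition, which together determine λR.
μ-injective : ∀ f g (1≤g : + 1 ≤ g) {L L' l l' ls ls'} (hyp : Hyp f g L (l ∷ ls)) (hyp' : Hyp f g L' (l' ∷ ls')) →
  mu f g L (l ∷ ls) ≡ mu f g L' (l' ∷ ls') → (L ≡ L') × (l ∷ ls ≡ l' ∷ ls')
μ-injective f g 1≤g {L} {L'} {l} {l'} {ls} {ls'} hyp hyp' eq =
  shift-injective C.u (proj₁ halves) , partitions-equal
  where
  module C = Construction f g 1≤g hyp
  module C' = Construction f g 1≤g hyp'
  halves : (shift C.u L ≡ shift C.u L') × (C.FD ≡ C'.FD)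
  halves = split-unique (shift C.u L) (shift C.u L') C.FD C'.FD
             C.prefix-bounded C'.prefix-bounded C.FD-starts-outside C'.FD-starts-outside eq
  dysons-equal : dysonWith C.m (l ∷ ls) ≡ dysonWith C'.m (l' ∷ ls')
  dysons-equal = frob-injective _ _ (dyson-partition C.m C.partR C.parts-bounded)
                   (dyson-partition C'.m C'.partR C'.parts-bounded) (proj₂ halves)
  recovered : (C.m ≡ C'.m) × (peel (l ∷ ls) ≡ peel (l' ∷ ls'))
  recovered = dyson-injective C.m C'.m C.parts-bounded C'.parts-bounded dysons-equal
  lengths-equal : length ls ≡ length ls'
  lengths-equal = ℤP.+-injective (begin
    + length ls                 ≡⟨ restore C.r (+ length ls) ⟩
    C.r + + length ls - C.r     ≡⟨ cong (_- C.r) (trans (sym C.m-value) (trans (cong +_ (proj₁ recovered)) C'.m-value)) ⟩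
    C.r + + length ls' - C.r    ≡⟨ restore C.r (+ length ls') ⟨
    + length ls'                ∎)
    where
    open ≡-Reasoning
    restore : ∀ (r k : ℤ) → k ≡ r + k - r
    restore = solve-∀
  partitions-equal : l ∷ ls ≡ l' ∷ ls'
  partitions-equal = peel-injective (l ∷ ls) (l' ∷ ls') C.partR C'.partR (cong suc lengths-equal) (proj₂ recovered)

lemma3p4 : (f g h : ℤ) → + 1 ≤ g → f + + 1 ≤ + 2 * g → h ≤ f →
    ((L : Array) (λR : List ℕ) → Hyp f g L λR →
      -- (1)
      IsFrob (mu f g L λR)
      -- (2)
      × All (λ c → proj₁ c - proj₂ c ≤ f - + 2 * g - + 2) (take (length L) (mu f g L λR))
      × (∀ x y rest → drop (length L) (mu f g L λR) ≡ (x , y) ∷ rest →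
           f - + 2 * g - + 1 ≤ x - y)
      -- (3)
      × (L ≢ [] → rankF L ≤ h → rankF (mu f g L λR) ≤ h - + 2 * g - + 2)
      -- (5)
      × (weight L + + sum λR - weight (mu f g L λR) ≡ + 2 * g - f))
    -- (4) the correspondence (L , R) ↦ μ is injective
    × ((L L' : Array) (λR λR' : List ℕ) → Hyp f g L λR → Hyp f g L' λR' →
         mu f g L λR ≡ mu f g L' λR' → (L ≡ L') × (λR ≡ λR'))
lemma3p4 f g h 1≤g _ _ =
  (λ where
    L [] hyp → ⊥-elim (Hyp.R-ne hyp refl)
    L (l ∷ ls) hyp → let open Construction f g 1≤g hyp in
      μ-isFrob , μ-prefix , μ-suffix , shift-++-rank g h L FD , μ-weight)
  ,
  (λ where
    L L' [] _ hyp _ _ → ⊥-elim (Hyp.R-ne hyp refl)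
    L L' (_ ∷ _) [] _ hyp' _ → ⊥-elim (Hyp.R-ne hyp' refl)
    L L' (_ ∷ _) (_ ∷ _) hyp hyp' eq → μ-injective f g 1≤g hyp hyp' eq)
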